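{- Let $k\ge2$, let $G$ be a graph, let $\mathcal{P}$ be the $k^+$-star packing output by the algorithm LocalSearch-$k^+$ on $G$, and let $\mathcal{Q}^*$ be a $k^+$-star packing of $G$ covering the maximum number of vertices. Then for every star $S$ of $\mathcal{Q}^*$, at most $k-1$ satellites of $S$ are not covered by $\mathcal{P}$.
   Context: For $\ell\ge1$, an $\ell$-star is a graph with one center vertex of degree $\ell$ adjacent to $\ell$ degree-$1$ satellites; a $k^+$-star is an $\ell$-star with $\ell\ge k$. A $k^+$-star packing of $G=(V,E)$ is a set of vertex-disjoint subgraphs of $G$ each a $k^+$-star; a vertex is covered if it lies in one of them. Algorithm LocalSearch-$k^+$: it maintains a $k^+$-star packing $\mathcal{P}$ (internal stars) and the remainder graph $R=G[V\setminus V(\mathcal{P})]$. Operations: Collect($v$): for a vertex $v$ of $R$ with degree $\ell\ge k$ in $R$, extract the $\ell$-star formed by $v$ and all its $R$-neighbours and add it to $\mathcal{P}$. Pull-by-$(k+1)^+$: given a satellite $v$ of an internal $(k+1)^+$-star, remove $v$ from that star and apply Collect to extract a $k^+$-star. Pull-by-$k$: given an internal $k$-star, remove it and apply Collect operations to extract a $(k+1)^+$-star, or if not possible two vertex-disjoint $k$-stars. Pull-by-$(k,(k+1)^+)$: remove an internal $k$-star and one satellite of an internal $(k+1)^+$-star and apply Collect operations to extract two vertex-disjoint $k^+$-stars. Pull-by-$(k,k)$: remove two internal $k$-stars and apply Collect operations to extract either vertex-disjoint $k^+$-star and $(k+1)^+$-star, or three vertex-disjoint $k$-stars. Starting from $\mathcal{P}=\emptyset$,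 while some Collect or Pull operation is applicable (can be carried out as described), apply it, then re-apply Collect on the center of every internal star (adding all uncovered neighbours of the center to that star) and update $R$; when none is applicable, output $\mathcal{P}$. -}

module Defs where

open import Data.Nat using (ℕ; suc; _≤_; _∸_)
open import Data.Bool using (Bool; true; false)
open import Data.Fin using (Fin; _≟_)
open import Data.List using (List; []; _∷_; length; concatMap; filter)
open import Data.List.Membership.Propositional using (_∈_; _∉_)
import Data.List.Membership.DecPropositional as DecMem
open import Data.List.Relation.Unary.All using (All)
open import Data.List.Relation.Unary.Any using (Any)
open import Data.List.Relation.Unary.Unique.Propositional using (Unique)
open import Data.Product using (Σ; ∃; ∃-syntax; _×_; _,_; proj₁; proj₂)
open import Data.Sum using (_⊎_)
open import Data.Unit using (⊤)
open import Relation.Nullary using (¬_; ¬?)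
open import Relation.Binary.PropositionalEquality using (_≡_; _≢_)
open import Function.Bundles using (_⇔_)

record Graph : Set where
  field
    n      : ℕ
    adj    : Fin n → Fin n → Bool
    sym    : ∀ u v → adj u v ≡ adj v u
    irrefl : ∀ v → adj v v ≡ false

module _ (G : Graph) where
  open Graph G
  open DecMem (_≟_ {n = n}) using (_∈?_)

  V : Set
  V = Fin n

  Edge : V → V → Set
  Edge u v = adj u v ≡ true

  Star : Set
  Star = V × List V

  center : Star → V
  center = proj₁

  sats : Star → List V
  sats = proj₂

  nsat : Star → ℕ
  nsat S = length (sats S)

  verts : Star → List V
  verts S = center S ∷ sats S

  IsKPlusStar : ℕ → Star → Set
  IsKPlusStar k S = Unique (sats S) × All (Edge (center S)) (sats S) × k ≤ nsat S

  coveredList : List Star → List V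
  coveredList P = concatMap verts P

  IsPacking : ℕ → List Star → Set
  IsPacking k P = All (IsKPlusStar k) P × Unique (coveredList P)

  Covered : List Star → V → Set
  Covered P v = v ∈ coveredList P

  IsMaxPacking : ℕ → List Star → Set
  IsMaxPacking k Q = IsPacking k Q ×
    (∀ Q' → IsPacking k Q' → length (coveredList Q') ≤ length (coveredList Q))

  -- Collect(v) in the remainder graph whose removed (covered) vertex set is C:
  -- v is uncovered, the satellites are exactly all uncovered neighbours of v,
  -- and their number is at least k.
  CollectIn : ℕ → (V → Set) → Star → Set
  CollectIn k C S =
    ¬ C (center S) × Unique (sats S) × k ≤ nsat S ×
    (∀ w → (w ∈ sats S) ⇔ (Edge (center S) w × ¬ C w))

  Collects : ℕ → (V → Set) → List Star → Set
  Collects k C [] = ⊤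
  Collects k C (S ∷ xs) = CollectIn k C S × Collects k (λ w → C w ⊎ w ∈ verts S) xs

  Big : ℕ → Star → Set
  Big k S = suc k ≤ nsat S

  numKStars : ℕ → List Star → ℕ
  numKStars k xs = length (filter (λ S → nsat S Data.Nat.≟ k) xs)

  CollectApplicable : ℕ → List Star → Set
  CollectApplicable k P = ∃[ S ] CollectIn k (Covered P) S

  PullBigApplicable : ℕ → List Star → Set
  PullBigApplicable k P =
    ∃[ T ] T ∈ P × Big k T × ∃[ v ] v ∈ sats T × ∃[ xs ]
      Collects k (λ w → Covered P w × w ≢ v) xs × 1 ≤ length xs

  PullKApplicable : ℕ → List Star → Set
  PullKApplicable k P =
    ∃[ T ] T ∈ P × nsat T ≡ k × ∃[ xs ]
      Collects k (λ w → Covered P w × w ∉ verts T) xs ×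
      (Any (Big k) xs ⊎ 2 ≤ numKStars k xs)

  PullKBigApplicable : ℕ → List Star → Set
  PullKBigApplicable k P =
    ∃[ T ] T ∈ P × nsat T ≡ k × ∃[ T' ] T' ∈ P × Big k T' ×
      ∃[ v ] v ∈ sats T' × ∃[ xs ]
      Collects k (λ w → Covered P w × w ∉ verts T × w ≢ v) xs × 2 ≤ length xs

  PullKKApplicable : ℕ → List Star → Set
  PullKKApplicable k P =
    ∃[ T₁ ] ∃[ T₂ ] T₁ ∈ P × T₂ ∈ P × T₁ ≢ T₂ × nsat T₁ ≡ k × nsat T₂ ≡ k ×
      ∃[ xs ]
      Collects k (λ w → Covered P w × w ∉ verts T₁ × w ∉ verts T₂) xs ×
      ((Any (Big k) xs × 2 ≤ length xs) ⊎ 3 ≤ numKStars k xs)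

  -- Every internal star's center has no uncovered neighbour
  -- (guaranteed by the re-application of Collect on all centers after each step).
  Saturated : List Star → Set
  Saturated P = ∀ T → T ∈ P → ∀ w → Edge (center T) w → Covered P w

  LocalSearchOutput : ℕ → List Star → Set
  LocalSearchOutput k P =
    IsPacking k P × Saturated P ×
    ¬ CollectApplicable k P × ¬ PullBigApplicable k P × ¬ PullKApplicable k P ×
    ¬ PullKBigApplicable k P × ¬ PullKKApplicable k P

  uncoveredSats : List Star → Star → ℕ
  uncoveredSats P S = length (filter (λ v → ¬? (v ∈? coveredList P)) (sats S))

{-# OPTIONS --safe #-}
-- Let S = (c, ss) be any star of G with k satellites U uncovered by the output P, and look at c.
-- If c is uncovered, Collect(c) applies.  If c is the center of an internal
-- star, saturation leaves it no uncovered neighbour, yet U ≠ ∅.  If c is a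
-- satellite of an internal star T: for a k-star T, dissolving T lets Collect(c)
-- take U together with the center of T, a (k+1)^+-star, so Pull-by-k applies;
-- for a (k+1)^+-star T, freeing c alone lets Collect(c) take at least U, so
-- Pull-by-(k+1)^+ applies.
module Submission where

open import Defs
open import Data.Nat using (ℕ; _≤_; _<_; _∸_; suc; z≤n; s≤s)
open import Data.Nat.Properties
  using (≤-trans; <⇒≤; ≰⇒>; m≤n⇒m<n∨m≡n; suc[m]≤n⇒m≤pred[n]; module ≤-Reasoning)
open import Data.Bool using (true)
import Data.Bool as Bool
open import Data.Fin using (_≟_)
open import Data.List using (List; []; _∷_; length; filter; allFin)
open import Data.List.Properties using (length-removeAt′; filter-none)
open import Data.List.Membership.Propositional using (_∈_; _∉_; find)
open import Data.List.Membership.Propositional.Properties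
  using (∈-filter⁺; ∈-filter⁻; ∈-allFin; ∈-concatMap⁺; ∈-concatMap⁻)
import Data.List.Membership.DecPropositional as DecMembership
open import Data.List.Relation.Binary.Subset.Propositional using (_⊆_)
open import Data.List.Relation.Unary.All as All using (All; _∷_)
open import Data.List.Relation.Unary.Any as Any using (here; there; index; _─_)
open import Data.List.Relation.Unary.AllPairs using ([]; _∷_)
open import Data.List.Relation.Unary.Unique.Propositional using (Unique)
open import Data.List.Relation.Unary.Unique.Propositional.Properties using (filter⁺; allFin⁺)
open import Data.Product using (∃-syntax; _×_; _,_; proj₁; proj₂)
open import Data.Sum using (_⊎_; inj₁; inj₂)
open import Data.Unit using (tt)
open import Function using (_∘_)
open import Function.Bundles using (_⇔_; mk⇔; Equivalence)
open import Relation.Nullary using (¬_; ¬?; yes; no; contradiction)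
open import Relation.Nullary.Decidable using (_×-dec_)
open import Relation.Unary using (Decidable)
open import Relation.Binary.PropositionalEquality using (_≡_; _≢_; refl; sym; trans; subst; ≢-sym)

module _ {A : Set} where

  ∈-─⁺ : ∀ {x y : A} {ys} (x∈ys : x ∈ ys) → y ∈ ys → y ≢ x → y ∈ (ys ─ x∈ys)
  ∈-─⁺ (here refl) (here refl) y≢x = contradiction refl y≢x
  ∈-─⁺ (here refl) (there y∈ys) _ = y∈ys
  ∈-─⁺ (there x∈ys) (here refl) _ = here refl
  ∈-─⁺ (there x∈ys) (there y∈ys) y≢x = there (∈-─⁺ x∈ys y∈ys y≢x)

  Unique-⊆⇒length≤ : ∀ {xs ys : List A} → Unique xs → xs ⊆ ys → length xs ≤ length ys
  Unique-⊆⇒length≤ [] _ = z≤n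
  Unique-⊆⇒length≤ {x ∷ xs} {ys} (x≢xs ∷ xs!) x∷xs⊆ys = begin
    suc (length xs)          ≤⟨ s≤s (Unique-⊆⇒length≤ xs! xs⊆ys─x) ⟩
    suc (length (ys ─ x∈ys)) ≡⟨ sym (length-removeAt′ ys (index x∈ys)) ⟩
    length ys                ∎
    where
    open ≤-Reasoning
    x∈ys : x ∈ ys
    x∈ys = x∷xs⊆ys (here refl)
    xs⊆ys─x : xs ⊆ (ys ─ x∈ys)
    xs⊆ys─x y∈xs = ∈-─⁺ x∈ys (x∷xs⊆ys (there y∈xs)) (≢-sym (All.lookup x≢xs y∈xs))

module _ (G : Graph) where
  open Graph G using (n; adj)
  open DecMembership (_≟_ {n = n}) using (_∈?_)

  Edge-sym : ∀ {u v} → Edge G u v → Edge G v u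
  Edge-sym {u} {v} e = trans (Graph.sym G v u) e

  FreeNeighbour : (V G → Set) → V G → V G → Set
  FreeNeighbour C c w = Edge G c w × ¬ C w

  freeNeighbour? : ∀ {C} → Decidable C → ∀ c → Decidable (FreeNeighbour C c)
  freeNeighbour? C? c w = (adj c w Bool.≟ true) ×-dec ¬? (C? w)

  collect : V G → ∀ {C} → Decidable C → Star G
  collect c C? = c , filter (freeNeighbour? C? c) (allFin n)

  collect-sats : ∀ {C} (C? : Decidable C) c w →
                 (w ∈ sats G (collect c C?)) ⇔ FreeNeighbour C c w
  collect-sats C? c w =
    mk⇔ (proj₂ ∘ ∈-filter⁻ (freeNeighbour? C? c) {xs = allFin n})
        (∈-filter⁺ (freeNeighbour? C? c) (∈-allFin w))

  collect-CollectIn : ∀ {k C} (C? : Decidable C) {c} → ¬ C c →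
                      k ≤ nsat G (collect c C?) → CollectIn G k C (collect c C?)
  collect-CollectIn C? {c} c∉C k≤ =
    c∉C , filter⁺ (freeNeighbour? C? c) (allFin⁺ n) , k≤ , collect-sats C? c

  length≤nsat-collect : ∀ {C} (C? : Decidable C) {c ws} → Unique ws →
                        All (FreeNeighbour C c) ws → length ws ≤ nsat G (collect c C?)
  length≤nsat-collect C? ws! free =
    Unique-⊆⇒length≤ ws! (λ w∈ws → Equivalence.from (collect-sats C? _ _) (All.lookup free w∈ws))

  covered? : (P : List (Star G)) → Decidable (Covered G P)
  covered? P w = w ∈? coveredList G P

  ∈-verts⇒Covered : ∀ {P T v} → T ∈ P → v ∈ verts G T → Covered G P v
  ∈-verts⇒Covered {v = v} T∈P v∈T =
    ∈-concatMap⁺ (verts G) (Any.map (λ { refl → v∈T }) T∈P)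

  Covered⇒center⊎satellite : ∀ {P v} → Covered G P v →
                             ∃[ T ] T ∈ P × (v ≡ center G T ⊎ v ∈ sats G T)
  Covered⇒center⊎satellite {P} v∈P with find (∈-concatMap⁻ (verts G) {xs = P} v∈P)
  ... | T , T∈P , here v≡c      = T , T∈P , inj₁ v≡c
  ... | T , T∈P , there v∈sats = T , T∈P , inj₂ v∈sats

  uncovered : List (Star G) → List (V G) → List (V G)
  uncovered P = filter (¬? ∘ covered? P)

  saturated-center⇒uncovered≡[] : ∀ {P T ss} → Saturated G P → T ∈ P →
                                  All (Edge G (center G T)) ss → uncovered P ss ≡ []
  saturated-center⇒uncovered≡[] {P} saturated T∈P c–ss =
    filter-none (¬? ∘ covered? P) (All.map (λ e w∉P → w∉P (saturated _ T∈P _ e)) c–ss)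

  module _ {k : ℕ} {P : List (Star G)} {c : V G} {ss : List (V G)}
           (ss! : Unique ss) (c–ss : All (Edge G c) ss)
           (k≤U : k ≤ length (uncovered P ss)) where

    private
      U : List (V G)
      U = uncovered P ss

      U! : Unique U
      U! = filter⁺ (¬? ∘ covered? P) ss!

      ∈-U⁻ : ∀ {w} → w ∈ U → w ∈ ss × ¬ Covered G P w
      ∈-U⁻ = ∈-filter⁻ (¬? ∘ covered? P)

      U-free : ∀ {C} → (∀ {w} → C w → Covered G P w) → All (FreeNeighbour C c) U
      U-free C⊆P = All.tabulate λ w∈U →
        All.lookup c–ss (proj₁ (∈-U⁻ w∈U)) , proj₂ (∈-U⁻ w∈U) ∘ C⊆P

      k≤collect : ∀ {C} (C? : Decidable C) → (∀ {w} → C w → Covered G P w) →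
                  k ≤ nsat G (collect c C?)
      k≤collect C? C⊆P = ≤-trans k≤U (length≤nsat-collect C? U! (U-free C⊆P))

    uncovered-center⇒collectable : ¬ Covered G P c → CollectApplicable G k P
    uncovered-center⇒collectable c∉P =
      collect c (covered? P) ,
      collect-CollectIn (covered? P) c∉P (k≤collect (covered? P) (λ w∈P → w∈P))

    internal-center⇒¬Saturated : 1 ≤ k → ∀ {T} → T ∈ P → c ≡ center G T → ¬ Saturated G P
    internal-center⇒¬Saturated 1≤k T∈P refl saturated
      with () ← ≤-trans 1≤k (subst (λ xs → k ≤ length xs)
                              (saturated-center⇒uncovered≡[] saturated T∈P c–ss) k≤U)

    satellite-of-k-star⇒pullable : ∀ {t ts} → (t , ts) ∈ P → All (Edge G t) ts →
                                   length ts ≡ k → c ∈ ts → PullKApplicable G k P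
    satellite-of-k-star⇒pullable {t} {ts} T∈P t–ts ts≡k c∈ts =
      (t , ts) , T∈P , ts≡k , collect c C? ∷ [] ,
      (collect-CollectIn C? (λ c∈C → proj₂ c∈C (there c∈ts)) (<⇒≤ k<collect) , tt) ,
      inj₁ (here k<collect)
      where
      C : V G → Set
      C w = Covered G P w × w ∉ verts G (t , ts)
      C? : Decidable C
      C? w = covered? P w ×-dec ¬? (w ∈? verts G (t , ts))
      t∉U : All (t ≢_) U
      t∉U = All.tabulate λ w∈U t≡w → proj₂ (∈-U⁻ w∈U) (∈-verts⇒Covered T∈P (here (sym t≡w)))
      k<collect : suc k ≤ nsat G (collect c C?)
      k<collect = ≤-trans (s≤s k≤U) (length≤nsat-collect C? (t∉U ∷ U!)
        ((Edge-sym (All.lookup t–ts c∈ts) , (λ t∈C → proj₂ t∈C (here refl))) ∷ U-free proj₁))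

    satellite-of-big-star⇒pullable : ∀ {T} → T ∈ P → Big G k T → c ∈ sats G T →
                                     PullBigApplicable G k P
    satellite-of-big-star⇒pullable {T} T∈P big c∈T =
      T , T∈P , big , c , c∈T , collect c C? ∷ [] ,
      (collect-CollectIn C? (λ c∈C → proj₂ c∈C refl) (k≤collect C? proj₁) , tt) , s≤s z≤n
      where
      C : V G → Set
      C w = Covered G P w × w ≢ c
      C? : Decidable C
      C? w = covered? P w ×-dec ¬? (w ≟ c)

  uncoveredSats<k : ∀ {k P} → 1 ≤ k → LocalSearchOutput G k P →
                    ∀ {S} → Unique (sats G S) → All (Edge G (center G S)) (sats G S) →
                    uncoveredSats G P S < k
  uncoveredSats<k {k} {P} 1≤k (packing , saturated , ¬collect , ¬pullBig , ¬pullK , _)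
                  {c , ss} ss! c–ss = ≰⇒> k≰U
    where
    k≰U : ¬ (k ≤ length (uncovered P ss))
    k≰U k≤U with covered? P c
    ... | no c∉P = ¬collect (uncovered-center⇒collectable {P = P} ss! c–ss k≤U c∉P)
    ... | yes c∈P with Covered⇒center⊎satellite c∈P
    ...   | T , T∈P , inj₁ c≡t =
      internal-center⇒¬Saturated {P = P} ss! c–ss k≤U 1≤k T∈P c≡t saturated
    ...   | T@(t , ts) , T∈P , inj₂ c∈ts with All.lookup (proj₁ packing) T∈P
    ...     | _ , t–ts , k≤ts with m≤n⇒m<n∨m≡n k≤ts
    ...       | inj₁ k<ts =
      ¬pullBig (satellite-of-big-star⇒pullable {P = P} ss! c–ss k≤U T∈P k<ts c∈ts)
    ...       | inj₂ k≡ts =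
      ¬pullK (satellite-of-k-star⇒pullable {P = P} ss! c–ss k≤U T∈P t–ts (sym k≡ts) c∈ts)

lemma3 : (k : ℕ) → 2 ≤ k → (G : Graph) → (P Q : List (Star G)) →
         LocalSearchOutput G k P → IsMaxPacking G k Q →
         ∀ S → S ∈ Q → uncoveredSats G P S ≤ k ∸ 1
lemma3 k 2≤k G P Q out ((stars , _) , _) S S∈Q =
  suc[m]≤n⇒m≤pred[n] (uncoveredSats<k G (≤-trans (s≤s z≤n) 2≤k) out ss! c–ss)
  where
  ss! : Unique (sats G S)
  ss! = proj₁ (All.lookup stars S∈Q)
  c–ss : All (Edge G (center G S)) (sats G S)
  c–ss = proj₁ (proj₂ (All.lookup stars S∈Q))
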